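{- Let $F^+(P_n)\in\mathbb{N}\cup\{*\}$ be the normal foreclosed Sprague-Grundy number of the path $P_n$, defined below. Suppose that for some integers $p>0$ and $q>0$ we have $$F^+(P_{n+p})=F^+(P_n)\quad\text{for every } n \text{ with } q\le n\le 2q+p+2.$$ Then $F^+(P_{n+p})=F^+(P_n)$ for every $n\ge q$.
   Context: For $n\ge 0$, $P_n$ denotes the path on $n$ vertices ($P_0$ is the empty graph). In Node-Kayles, a move on a graph consists in choosing a vertex $v$ and deleting $v$ together with all its neighbours. Hence for $n\ge 4$ the options of $P_n$ are $P_{n-2}$, $P_{n-3}$ and the disjoint unions $P_i\cup P_j$ with $j\ge i\ge 1$, $i+j=n-3$. The sequence $F^+(P_n)$ takes values in $\mathbb{N}\cup\{*\}$, where $*$ means "undefined", and is defined recursively by $F^+(P_0)=F^+(P_1)=F^+(P_2)=F^+(P_3)=*$ and, for $n\ge 4$, $$F^+(P_n)=\mathrm{mex}\big(\{F^+(P_{n-2}),F^+(P_{n-3})\}\cup\{F^+(P_i)\oplus F^+(P_j):\ j\ge i\ge 1,\ i+j=n-3\}\big).$$ Here $\oplus$ is bitwise XOR (Nim-sum) on nonnegative integers, extended by $x\oplus *=*\oplus x=*$ for every $x$. The value $\mathrm{mex}(S)$ is the least nonnegative integer not belonging to $S$; elements equal to $*$ are ignored. Equalities in the statement are equalities in $\mathbb{N}\cup\{*\}$. -}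

module Defs where

open import Data.Nat using (ℕ; zero; suc; _+_; _∸_; _≡ᵇ_; _≤ᵇ_)
open import Data.Nat using (_*_; _/_; _%_)
open import Data.Bool using (Bool; true; false; _∨_; if_then_else_) renaming (_xor_ to _xorᵇ_)
open import Data.Maybe using (Maybe; just; nothing)
open import Data.List using (List; []; _∷_; _++_; length; map; upTo; filterᵇ)

-- ℕ ∪ {*} is modelled as Maybe ℕ, with  nothing = *  and  just k = k.

-- bitwise XOR on ℕ (Nim-sum), by recursion on the bits with fuel
-- (fuel a + b suffices since both arguments halve at each step).
xorFuel : ℕ → ℕ → ℕ → ℕ
xorFuel zero a b = 0
xorFuel (suc f) a b =
  (if (a % 2 ≡ᵇ b % 2) then 0 else 1) + 2 * xorFuel f (a / 2) (b / 2)

_xor_ : ℕ → ℕ → ℕ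
a xor b = xorFuel (a + b) a b

_⊕_ : Maybe ℕ → Maybe ℕ → Maybe ℕ
just a ⊕ just b = just (a xor b)
_ ⊕ _ = nothing

_∈ᵇ_ : ℕ → List (Maybe ℕ) → Bool
k ∈ᵇ [] = false
k ∈ᵇ (just x ∷ xs) = (k ≡ᵇ x) ∨ (k ∈ᵇ xs)
k ∈ᵇ (nothing ∷ xs) = k ∈ᵇ xs

mexFrom : ℕ → ℕ → List (Maybe ℕ) → ℕ
mexFrom zero start S = start
mexFrom (suc fuel) start S =
  if start ∈ᵇ S then mexFrom fuel (suc start) S else start

-- mex(S): least natural number not in S (elements equal to * ignored).
-- Fuel length S + 1 suffices since at most length S values are excluded.
mex : List (Maybe ℕ) → ℕ
mex S = mexFrom (suc (length S)) 0 S

-- index into a list of earlier values (default * when out of range; never used)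
at : List (Maybe ℕ) → ℕ → Maybe ℕ
at [] _ = nothing
at (x ∷ xs) zero = x
at (x ∷ xs) (suc i) = at xs i

-- Given prev = [F⁺(P_0), …, F⁺(P_{n-1})], compute F⁺(P_n).
step : ℕ → List (Maybe ℕ) → Maybe ℕ
step 0 prev = nothing
step 1 prev = nothing
step 2 prev = nothing
step 3 prev = nothing
step n@(suc (suc (suc (suc _)))) prev =
  just (mex (at prev (n ∸ 2) ∷ at prev (n ∸ 3) ∷ pairVals))
  where
  -- the options P_i ∪ P_j with j ≥ i ≥ 1 and i + j = n - 3
  m : ℕ
  m = n ∸ 3
  pairVals : List (Maybe ℕ)
  pairVals = map (λ i → at prev i ⊕ at prev (m ∸ i))
                 (filterᵇ (λ i → i ≤ᵇ (m ∸ i)) (map suc (upTo (m ∸ 1))))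

table : ℕ → List (Maybe ℕ)
table zero = []
table (suc n) = let t = table n in t ++ (step n t ∷ [])

Fplus : ℕ → Maybe ℕ
Fplus n = at (table (suc n)) n

-- For n ≥ 4, F⁺(P n) is the mex of the values of the options of P n, and it is determined by
-- the set of those values.  Past the initial window, the options of P (n + p) and of P n have
-- the same values: P (n + p - 2) and P (n + p - 3) agree with P (n - 2) and P (n - 3) by
-- induction, a split P i ∪ P j of n + p - 3 has a part j ≥ q + p that can be shortened to
-- j - p, and a split of n - 3 has a part j ≥ q that can be lengthened to j + p, neither
-- changing the Nim-sum.  So periodicity extends one step at a time.

module Submission where

open import Defs
open import Data.Bool using (true; false; T)
open import Data.Bool.Properties using (T-∨; T-≡)
open import Data.Empty using (⊥-elim)
open import Data.Fin using (Fin; toℕ)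
open import Data.Fin.Properties using (toℕ<n; toℕ-injective; injective⇒≤)
open import Data.List using (List; []; _∷_; _++_; length; lookup; map; upTo; filterᵇ)
open import Data.List.Properties using (length-++)
open import Data.List.Membership.Propositional using (_∈_)
open import Data.List.Membership.Propositional.Properties using (∈-map⁺; ∈-map⁻; ∈-filter⁺; ∈-filter⁻; ∈-upTo⁺)
open import Data.List.Relation.Unary.Any using (here; there; index)
open import Data.List.Relation.Unary.Any.Properties using (lookup-index)
open import Data.Maybe using (Maybe; just; nothing)
open import Data.Maybe.Properties using (just-injective)
open import Data.Nat using (ℕ; zero; suc; _+_; _*_; _∸_; _≤_; _<_; _≡ᵇ_; _≤ᵇ_; _%_; _/_; z≤n; s≤s; _<?_; _≤?_; _≟_)
open import Data.Nat.Properties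
open import Data.Nat.Tactic.RingSolver using (solve-∀)
open import Data.Product using (_×_; _,_; ∃₂; ∃-syntax)
open import Data.Sum using (_⊎_; inj₁; inj₂)
open import Function using (Equivalence; _⇔_; mk⇔; _∘_)
open import Relation.Binary.Definitions using (tri<; tri≈; tri>)
open import Relation.Binary.PropositionalEquality
open import Relation.Nullary using (¬_; yes; no)
open import Relation.Nullary.Decidable using (T?)

open Equivalence using (to; from)

length-table : ∀ n → length (table n) ≡ n
length-table zero = refl
length-table (suc n) = begin
  length (table n ++ _ ∷ [])  ≡⟨ length-++ (table n) ⟩
  length (table n) + 1        ≡⟨ cong (_+ 1) (length-table n) ⟩
  n + 1                       ≡⟨ +-comm n 1 ⟩
  suc n                       ∎
  where open ≡-Reasoning

at-++ˡ : ∀ (xs ys : List (Maybe ℕ)) {i} → i < length xs → at (xs ++ ys) i ≡ at xs i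
at-++ˡ (x ∷ xs) ys {zero} _ = refl
at-++ˡ (x ∷ xs) ys {suc i} (s≤s i<n) = at-++ˡ xs ys i<n

at-++-length : ∀ (xs : List (Maybe ℕ)) y → at (xs ++ y ∷ []) (length xs) ≡ y
at-++-length [] y = refl
at-++-length (x ∷ xs) y = at-++-length xs y

Fplus-step : ∀ n → Fplus n ≡ step n (table n)
Fplus-step n = subst (λ l → at (table n ++ y ∷ []) l ≡ y) (length-table n) (at-++-length (table n) y)
  where y = step n (table n)

at-table : ∀ {n i} → i < n → at (table n) i ≡ Fplus i
at-table {suc n} {i} i<1+n with i <? n
... | yes i<n = trans (at-++ˡ (table n) _ (subst (i <_) (sym (length-table n)) i<n)) (at-table i<n)
... | no i≮n with ≤-antisym (≤-pred i<1+n) (≮⇒≥ i≮n)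
... | refl = refl

≡ᵇ-comm : ∀ m n → (m ≡ᵇ n) ≡ (n ≡ᵇ m)
≡ᵇ-comm zero zero = refl
≡ᵇ-comm zero (suc n) = refl
≡ᵇ-comm (suc m) zero = refl
≡ᵇ-comm (suc m) (suc n) = ≡ᵇ-comm m n

xorFuel-comm : ∀ f a b → xorFuel f a b ≡ xorFuel f b a
xorFuel-comm zero a b = refl
xorFuel-comm (suc f) a b rewrite ≡ᵇ-comm (a % 2) (b % 2) | xorFuel-comm f (a / 2) (b / 2) = refl

⊕-comm : ∀ x y → x ⊕ y ≡ y ⊕ x
⊕-comm (just a) (just b) = cong just (trans (xorFuel-comm (a + b) a b) (cong (λ f → xorFuel f b a) (+-comm a b)))
⊕-comm (just a) nothing = refl
⊕-comm nothing (just b) = refl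
⊕-comm nothing nothing = refl

∈ᵇ⇒∈ : ∀ {k} xs → T (k ∈ᵇ xs) → just k ∈ xs
∈ᵇ⇒∈ (nothing ∷ xs) k∈ = there (∈ᵇ⇒∈ xs k∈)
∈ᵇ⇒∈ {k} (just x ∷ xs) k∈ with to T-∨ k∈
... | inj₁ k≡x = here (cong just (≡ᵇ⇒≡ k x k≡x))
... | inj₂ k∈xs = there (∈ᵇ⇒∈ xs k∈xs)

∈⇒∈ᵇ : ∀ {k xs} → just k ∈ xs → T (k ∈ᵇ xs)
∈⇒∈ᵇ {k} {just x ∷ xs} (here refl) = from T-∨ (inj₁ (≡⇒≡ᵇ k k refl))
∈⇒∈ᵇ {k} {just x ∷ xs} (there k∈) = from T-∨ (inj₂ (∈⇒∈ᵇ k∈))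
∈⇒∈ᵇ {k} {nothing ∷ xs} (there k∈) = ∈⇒∈ᵇ k∈

-- Pigeonhole: the positions of 0, …, r - 1 in S are distinct.
initial-segment⊆⇒≤length : ∀ {r} S → (∀ {j} → j < r → just j ∈ S) → r ≤ length S
initial-segment⊆⇒≤length {r} S ⊆S = injective⇒≤ {f = position} position-injective
  where
  position : Fin r → Fin (length S)
  position i = index (⊆S (toℕ<n i))
  position-injective : ∀ {i i′} → position i ≡ position i′ → i ≡ i′
  position-injective {i} {i′} eq = toℕ-injective (just-injective (begin
    just (toℕ i)           ≡⟨ lookup-index (⊆S (toℕ<n i)) ⟩
    lookup S (position i)  ≡⟨ cong (lookup S) eq ⟩
    lookup S (position i′) ≡⟨ lookup-index (⊆S (toℕ<n i′)) ⟨
    just (toℕ i′)          ∎))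
    where open ≡-Reasoning

mexFrom-below : ∀ f s S {j} → s ≤ j → j < mexFrom f s S → just j ∈ S
mexFrom-below zero s S s≤j j<s = ⊥-elim (<⇒≱ j<s s≤j)
mexFrom-below (suc f) s S {j} s≤j j<m with s ∈ᵇ S in s∈S
... | false = ⊥-elim (<⇒≱ j<m s≤j)
... | true with s ≟ j
...   | yes refl = ∈ᵇ⇒∈ S (from T-≡ s∈S)
...   | no s≢j = mexFrom-below f (suc s) S (≤∧≢⇒< s≤j s≢j) j<m

mexFrom-∈⇒fuel-exhausted : ∀ f s S → just (mexFrom f s S) ∈ S → mexFrom f s S ≡ s + f
mexFrom-∈⇒fuel-exhausted zero s S _ = sym (+-identityʳ s)
mexFrom-∈⇒fuel-exhausted (suc f) s S m∈S with s ∈ᵇ S in s∈S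
... | false = ⊥-elim (subst T s∈S (∈⇒∈ᵇ m∈S))
... | true = trans (mexFrom-∈⇒fuel-exhausted f (suc s) S m∈S) (sym (+-suc s f))

mex-minimal : ∀ S {j} → j < mex S → just j ∈ S
mex-minimal S = mexFrom-below (suc (length S)) 0 S z≤n

mex-∉ : ∀ S → ¬ just (mex S) ∈ S
mex-∉ S m∈S = <-irrefl refl (begin-strict
  length S       <⟨ n<1+n (length S) ⟩
  suc (length S) ≡⟨ mexFrom-∈⇒fuel-exhausted (suc (length S)) 0 S m∈S ⟨
  mex S          ≤⟨ initial-segment⊆⇒≤length S (mex-minimal S) ⟩
  length S       ∎)
  where open ≤-Reasoning

mex-cong : ∀ {S S′} → (∀ {k} → just k ∈ S → just k ∈ S′) → (∀ {k} → just k ∈ S′ → just k ∈ S) →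
           mex S ≡ mex S′
mex-cong {S} {S′} S⊆S′ S′⊆S with <-cmp (mex S) (mex S′)
... | tri≈ _ eq _ = eq
... | tri< lt _ _ = ⊥-elim (mex-∉ S (S′⊆S (mex-minimal S′ lt)))
... | tri> _ _ gt = ⊥-elim (mex-∉ S′ (S⊆S′ (mex-minimal S gt)))

data SplitValue (m v : ℕ) : Set where
  split : ∀ i j → 1 ≤ i → 1 ≤ j → i + j ≡ m → Fplus i ⊕ Fplus j ≡ just v → SplitValue m v

data OptionValue (k v : ℕ) : Set where
  end-vertex    : Fplus (2 + k) ≡ just v → OptionValue k v
  second-vertex : Fplus (1 + k) ≡ just v → OptionValue k v
  inner-vertex  : SplitValue (1 + k) v → OptionValue k v

splitIndices : ℕ → List ℕ
splitIndices k = filterᵇ (λ i → i ≤ᵇ (suc k ∸ i)) (map suc (upTo k))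

splitValue : ℕ → ℕ → Maybe ℕ
splitValue k i = at t i ⊕ at t (suc k ∸ i)
  where t = table (4 + k)

splitValues : ℕ → List (Maybe ℕ)
splitValues k = map (splitValue k) (splitIndices k)

-- Definitionally the list whose mex step (4 + k) takes.
optionList : ℕ → List (Maybe ℕ)
optionList k = at t (2 + k) ∷ at t (1 + k) ∷ splitValues k
  where t = table (4 + k)

Fplus-mex : ∀ k → Fplus (4 + k) ≡ just (mex (optionList k))
Fplus-mex k = Fplus-step (4 + k)

∈-splitIndices⁻ : ∀ {k i} → i ∈ splitIndices k → 1 ≤ i × i ≤ suc k ∸ i
∈-splitIndices⁻ {k} i∈ with ∈-filter⁻ (λ i → T? (i ≤ᵇ (suc k ∸ i))) {xs = map suc (upTo k)} i∈
... | i∈suc , i≤ with ∈-map⁻ suc i∈suc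
...   | _ , _ , refl = s≤s z≤n , ≤ᵇ⇒≤ _ _ i≤

∈-splitIndices⁺ : ∀ {k i} → 1 ≤ i → i ≤ suc k ∸ i → i ∈ splitIndices k
∈-splitIndices⁺ {k} {suc i} _ i≤ =
  ∈-filter⁺ (λ i → T? (i ≤ᵇ (suc k ∸ i))) (∈-map⁺ suc (∈-upTo⁺ (≤-trans i≤ (m∸n≤m k i)))) (≤⇒≤ᵇ i≤)

at-table₄ : ∀ {k i} → i ≤ 2 + k → at (table (4 + k)) i ≡ Fplus i
at-table₄ i≤ = at-table (s≤s (m≤n⇒m≤1+n i≤))

∈-splitValues⁻ : ∀ {k v} → just v ∈ splitValues k → SplitValue (1 + k) v
∈-splitValues⁻ {k} v∈ with ∈-map⁻ (splitValue k) v∈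
... | i , i∈ , eq with ∈-splitIndices⁻ i∈
...   | 1≤i , i≤j = split i (suc k ∸ i) 1≤i (≤-trans 1≤i i≤j) (m+[n∸m]≡n i≤1+k)
                      (trans (sym (cong₂ _⊕_ (at-table₄ (m≤n⇒m≤1+n i≤1+k)) (at-table₄ (m≤n⇒m≤1+n j≤1+k)))) (sym eq))
  where
  j≤1+k : suc k ∸ i ≤ suc k
  j≤1+k = m∸n≤m (suc k) i
  i≤1+k : i ≤ suc k
  i≤1+k = ≤-trans i≤j j≤1+k

ordered-split∈splitValues : ∀ {k v} i j → 1 ≤ i → i ≤ j → i + j ≡ suc k → Fplus i ⊕ Fplus j ≡ just v →
                            just v ∈ splitValues k
ordered-split∈splitValues {k} {v} i j 1≤i i≤j i+j≡ eq =
  subst (_∈ splitValues k) value (∈-map⁺ (splitValue k) (∈-splitIndices⁺ 1≤i (subst (i ≤_) (sym j≡) i≤j)))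
  where
  j≡ : suc k ∸ i ≡ j
  j≡ = trans (cong (_∸ i) (sym i+j≡)) (m+n∸m≡n i j)
  part≤ : ∀ {x} → x ≤ i + j → x ≤ 2 + k
  part≤ {x} x≤ = m≤n⇒m≤1+n (subst (x ≤_) i+j≡ x≤)
  value : splitValue k i ≡ just v
  value rewrite j≡ = trans (cong₂ _⊕_ (at-table₄ (part≤ (m≤m+n i j))) (at-table₄ (part≤ (m≤n+m j i)))) eq

∈-splitValues⁺ : ∀ {k v} → SplitValue (1 + k) v → just v ∈ splitValues k
∈-splitValues⁺ (split i j 1≤i 1≤j i+j≡ eq) with ≤-total i j
... | inj₁ i≤j = ordered-split∈splitValues i j 1≤i i≤j i+j≡ eq
... | inj₂ j≤i = ordered-split∈splitValues j i 1≤j j≤i (trans (+-comm j i) i+j≡) (trans (⊕-comm (Fplus j) (Fplus i)) eq)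

∈-optionList⁻ : ∀ {k v} → just v ∈ optionList k → OptionValue k v
∈-optionList⁻ {k} (here eq) = end-vertex (trans (sym (at-table₄ {k} ≤-refl)) (sym eq))
∈-optionList⁻ {k} (there (here eq)) = second-vertex (trans (sym (at-table₄ {k} (n≤1+n _))) (sym eq))
∈-optionList⁻ (there (there v∈)) = inner-vertex (∈-splitValues⁻ v∈)

∈-optionList⁺ : ∀ {k v} → OptionValue k v → just v ∈ optionList k
∈-optionList⁺ {k} (end-vertex eq) = here (sym (trans (at-table₄ {k} ≤-refl) eq))
∈-optionList⁺ {k} (second-vertex eq) = there (here (sym (trans (at-table₄ {k} (n≤1+n _)) eq)))
∈-optionList⁺ (inner-vertex s) = there (there (∈-splitValues⁺ s))

Fplus-cong-optionValues : ∀ {k k′} → (∀ {v} → OptionValue k v ⇔ OptionValue k′ v) → Fplus (4 + k) ≡ Fplus (4 + k′)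
Fplus-cong-optionValues {k} {k′} same = begin
  Fplus (4 + k)              ≡⟨ Fplus-mex k ⟩
  just (mex (optionList k))  ≡⟨ cong just (mex-cong (∈-optionList⁺ ∘ to same ∘ ∈-optionList⁻)
                                                    (∈-optionList⁺ ∘ from same ∘ ∈-optionList⁻)) ⟩
  just (mex (optionList k′)) ≡⟨ Fplus-mex k′ ⟨
  Fplus (4 + k′)             ∎
  where open ≡-Reasoning

PeriodicOn : ℕ → ℕ → ℕ → Set
PeriodicOn p q N = ∀ {n} → q ≤ n → n < N → Fplus (n + p) ≡ Fplus n

periodicOn-mono : ∀ {p q N N′} → N ≤ N′ → PeriodicOn p q N′ → PeriodicOn p q N
periodicOn-mono N≤N′ per q≤n n<N = per q≤n (<-≤-trans n<N N≤N′)

large-part : ∀ {t i j} → t + t ≤ i + j → t ≤ i ⊎ t ≤ j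
large-part {t} {i} {j} t+t≤ with t ≤? i | t ≤? j
... | yes t≤i | _ = inj₁ t≤i
... | no _ | yes t≤j = inj₂ t≤j
... | no t≰i | no t≰j = ⊥-elim (<⇒≱ (+-mono-< (≰⇒> t≰i) (≰⇒> t≰j)) t+t≤)

splitValue-largeʳ : ∀ {t m v} → t + t ≤ m → SplitValue m v →
                    ∃₂ λ i j → 1 ≤ i × t ≤ j × i + j ≡ m × Fplus i ⊕ Fplus j ≡ just v
splitValue-largeʳ t+t≤m (split i j 1≤i 1≤j i+j≡ eq) with large-part (subst (_ ≤_) (sym i+j≡) t+t≤m)
... | inj₂ t≤j = i , j , 1≤i , t≤j , i+j≡ , eq
... | inj₁ t≤i = j , i , 1≤j , t≤i , trans (+-comm j i) i+j≡ , trans (⊕-comm (Fplus j) (Fplus i)) eq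

splitValue-+p : ∀ {p q m v} → 0 < q → PeriodicOn p q m → q + q ≤ m → SplitValue m v → SplitValue (m + p) v
splitValue-+p {p} 0<q per q+q≤m s with splitValue-largeʳ q+q≤m s
... | i , j , 1≤i , q≤j , i+j≡m , eq =
  split i (j + p) 1≤i (≤-trans 0<q (≤-trans q≤j (m≤m+n j p)))
        (trans (sym (+-assoc i j p)) (cong (_+ p) i+j≡m))
        (trans (cong (Fplus i ⊕_) (per q≤j (subst (j <_) i+j≡m (m<n+m j 1≤i)))) eq)

m+m+n+n≡[m+n]+[m+n] : ∀ m n → m + m + n + n ≡ (m + n) + (m + n)
m+m+n+n≡[m+n]+[m+n] = solve-∀

splitValue-∸p : ∀ {p q m v} → 0 < q → PeriodicOn p q m → q + q + p ≤ m → SplitValue (m + p) v → SplitValue m v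
splitValue-∸p {p} {q} {m} 0<q per bound s
  with splitValue-largeʳ {t = q + p} (subst (_≤ m + p) (m+m+n+n≡[m+n]+[m+n] q p) (+-monoˡ-≤ p bound)) s
... | i , j , 1≤i , q+p≤j , i+j≡ , eq =
  split i j′ 1≤i (≤-trans 0<q q≤j′) i+j′≡m (trans (cong (Fplus i ⊕_) (sym Fj≡Fj′)) eq)
  where
  j′ = j ∸ p
  j′+p≡j : j′ + p ≡ j
  j′+p≡j = m∸n+n≡m (≤-trans (m≤n+m p q) q+p≤j)
  q≤j′ : q ≤ j′
  q≤j′ = subst (_≤ j′) (m+n∸n≡m q p) (∸-monoˡ-≤ p q+p≤j)
  i+j′≡m : i + j′ ≡ m
  i+j′≡m = +-cancelʳ-≡ p (i + j′) m (trans (+-assoc i j′ p) (trans (cong (i +_) j′+p≡j) i+j≡))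
  Fj≡Fj′ : Fplus j ≡ Fplus j′
  Fj≡Fj′ = trans (cong Fplus (sym j′+p≡j)) (per q≤j′ (subst (j′ <_) i+j′≡m (m<n+m j′ 1≤i)))

optionValue-periodic : ∀ {p q k} → 0 < q → q + q + p ≤ suc k → PeriodicOn p q (3 + k) →
                       ∀ {v} → OptionValue (k + p) v ⇔ OptionValue k v
optionValue-periodic {p} {q} {k} 0<q bound per = mk⇔ down up
  where
  q≤1+k : q ≤ suc k
  q≤1+k = ≤-trans (≤-trans (m≤m+n q q) (m≤m+n (q + q) p)) bound
  F[2+k] : Fplus (2 + k + p) ≡ Fplus (2 + k)
  F[2+k] = per (m≤n⇒m≤1+n q≤1+k) ≤-refl
  F[1+k] : Fplus (1 + k + p) ≡ Fplus (1 + k)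
  F[1+k] = per q≤1+k (n≤1+n (2 + k))
  per-splits : PeriodicOn p q (1 + k)
  per-splits = periodicOn-mono (≤-trans (n≤1+n (1 + k)) (n≤1+n (2 + k))) per
  down : ∀ {v} → OptionValue (k + p) v → OptionValue k v
  down (end-vertex eq) = end-vertex (trans (sym F[2+k]) eq)
  down (second-vertex eq) = second-vertex (trans (sym F[1+k]) eq)
  down (inner-vertex s) = inner-vertex (splitValue-∸p 0<q per-splits bound s)
  up : ∀ {v} → OptionValue k v → OptionValue (k + p) v
  up (end-vertex eq) = end-vertex (trans F[2+k] eq)
  up (second-vertex eq) = second-vertex (trans F[1+k] eq)
  up (inner-vertex s) = inner-vertex (splitValue-+p 0<q per-splits (≤-trans (m≤m+n (q + q) p) bound) s)

2*m+n+2≡2+[m+m+n] : ∀ m n → 2 * m + n + 2 ≡ 2 + (m + m + n)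
2*m+n+2≡2+[m+m+n] = solve-∀

beyond-initial : ∀ {p q n} → 0 < q → 2 * q + p + 2 < n → ∃[ k ] n ≡ 4 + k × q + q + p ≤ suc k
beyond-initial {p} {suc q} {n} _ bound<n with subst (_< n) (2*m+n+2≡2+[m+m+n] (suc q) p) bound<n
... | s≤s (s≤s (s≤s (s≤s le))) = _ , refl , s≤s le

periodicOn-extend : ∀ {p q N} → 0 < q → 2 * q + p + 2 < N → PeriodicOn p q N → PeriodicOn p q (suc N)
periodicOn-extend {N = N} 0<q bound<N per {n} q≤n n<1+N with n <? N
... | yes n<N = per q≤n n<N
... | no n≮N with ≤-antisym (≤-pred n<1+N) (≮⇒≥ n≮N) | beyond-initial 0<q bound<N
...   | refl | k , refl , bound =
  Fplus-cong-optionValues (optionValue-periodic 0<q bound (periodicOn-mono (n≤1+n (3 + k)) per))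

theorem1 : (p q : ℕ) → 0 < p → 0 < q →
    ((n : ℕ) → q ≤ n → n ≤ 2 * q + p + 2 → Fplus (n + p) ≡ Fplus n) →
    (n : ℕ) → q ≤ n → Fplus (n + p) ≡ Fplus n
theorem1 p q _ 0<q initial n q≤n = periodicOn (suc n) q≤n ≤-refl
  where
  periodicOn : ∀ N → PeriodicOn p q N
  periodicOn zero _ ()
  periodicOn (suc N) with N ≤? 2 * q + p + 2
  ... | yes N≤ = λ q≤n n<1+N → initial _ q≤n (≤-trans (≤-pred n<1+N) N≤)
  ... | no N≰ = periodicOn-extend 0<q (≰⇒> N≰) (periodicOn N)
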